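{- For $n\geq 2$ and $0\leq k\leq n$ with $n+k$ even, $|MDP(n;k)|=\frac{k+3}{n+1}\binom{n+1}{\frac{n-k}{2}-1}$.
   Context: For integers $i\ge j\ge 0$ with $i+j$ even, $D(i,j)$ denotes the set of lattice paths from $(0,0)$ to $(i,j)$ consisting of steps $(1,1)$ (up-steps) and $(1,-1)$ (down-steps) that never go below the $x$-axis ($D(0,0)$ consists of the empty path). A Dyck path with $2m$ steps starting at $(x,0)$ is such a path from $(x,0)$ to $(x+2m,0)$ never going below the $x$-axis. A modified Dyck path with a single drop from height $k$ (of length $n$) is a lattice path obtained, for some integer $1\leq i\leq \frac{n-k}{2}$, as the union of a path in $D(n-2i,k)$ and a Dyck path with $2i$ steps starting at $(n-2i,0)$; $MDP(n;k)$ denotes the set of all such paths (so $|MDP(n;k)|=\sum_{i=1}^{(n-k)/2}|D(n-2i,k)|\cdot C_i$, with $C_i$ the Catalan number). Here $\binom{a}{b}=0$ for $b<0$. -}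

module Defs where

open import Data.Nat.Base using (ℕ; zero; suc; _+_; _*_; _∸_; ⌊_/2⌋)
open import Data.Nat.Combinatorics using (_C_)
open import Data.Bool.Base using (Bool; true; false; _∧_)
open import Data.Maybe.Base using (Maybe; just; nothing)
open import Data.List.Base using (List; []; _∷_; _++_; map; concatMap; filter; length; take; drop; upTo)
open import Data.Nat.ListAction using (sum)
open import Relation.Nullary.Decidable using (⌊_⌋)
open import Data.Nat.Properties using (_≟_)

-- Steps of a lattice path: U = (1,1), Dn = (1,-1).
data Step : Set where
  U Dn : Step

allSeqs : ℕ → List (List Step)
allSeqs zero = [] ∷ []
allSeqs (suc n) = concatMap (λ s → (U ∷ s) ∷ (Dn ∷ s) ∷ []) (allSeqs n)

walk : ℕ → List Step → Maybe ℕ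
walk h [] = just h
walk h (U ∷ s) = walk (suc h) s
walk zero (Dn ∷ s) = nothing
walk (suc h) (Dn ∷ s) = walk h s

endsAt : ℕ → List Step → Bool
endsAt j s with walk 0 s
... | just h = ⌊ h ≟ j ⌋
... | nothing = false

-- A modified Dyck path of length n with a single drop from height k,
-- with drop parameter i: the step word w of length n whose first n-2i
-- steps form a path in D(n-2i,k) and whose last 2i steps form a Dyck path
-- (starting at (n-2i,0)). The pair (i , w) determines the path and conversely.
isMDPwith : ℕ → ℕ → ℕ → List Step → Bool
isMDPwith n k i w =
  endsAt k (take (n ∸ 2 * i) w) ∧ endsAt 0 (drop (n ∸ 2 * i) w)

mdpCount : ℕ → ℕ → ℕ
mdpCount n k =
  sum (map (λ j → length (filter (λ w → isMDPwith n k (suc j) w ≟b true) (allSeqs n)))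
           (upTo ⌊ (n ∸ k) /2⌋))
  where
  open import Relation.Binary.PropositionalEquality using (_≡_)
  open import Data.Bool.Properties using () renaming (_≟_ to _≟b_)

-- Binomial coefficient binom(a, b - 1) with the convention binom(a,-1) = 0.
binomPred : ℕ → ℕ → ℕ
binomPred a zero = 0
binomPred a (suc b) = a C b

{-# OPTIONS --safe #-}
-- Write n = k + 2r and B(k, r) = |D(k + 2r, k)|.  Cutting an MDP word after its first
-- n - 2i steps gives |MDP(n; k)| = Σ_{i=1}^{r} B(k, r - i) · B(0, i), and the last-step
-- recursion of B turns this convolution into B(k + 2, r - 1) = |D(n, k + 2)|.  The
-- reflection principle B(j, s) = C(j + 2s, s) - C(j + 2s, s - 1) together with the
-- absorption identity yields the ballot formula (j + 2s + 1) B(j, s) = (j + 1) C(j + 2s + 1, s),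
-- which for j = k + 2 is the claim.
module Submission where

open import Defs
open import Data.Bool.Base using (Bool; true; false; _∧_)
open import Data.Bool.Properties using () renaming (_≟_ to _≟ᵇ_)
open import Data.List.Base using (List; []; _∷_; map; filter; length; take; drop; upTo; applyUpTo; concatMap)
open import Data.List.Properties using (map-applyUpTo)
open import Data.Maybe.Base using (Maybe; just; nothing)
open import Data.Nat.Base using (ℕ; zero; suc; _+_; _*_; _∸_; _≤_; _<_; ⌊_/2⌋; _≡ᵇ_; z≤n; s≤s)
open import Data.Nat.Combinatorics using (_C_; nCk+nC[k+1]≡[n+1]C[k+1]; nCk≡nC[n∸k]; nC1≡n; k>n⇒nCk≡0)
open import Data.Nat.Divisibility using (_∣_; divides; ∣m+n∣m⇒∣n; m∣m*n)
open import Data.Nat.ListAction using (sum)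
open import Data.Nat.Properties
open import Algebra.Properties.CommutativeSemigroup +-commutativeSemigroup using (interchange; xy∙z≈xz∙y)
open import Data.Nat.Tactic.RingSolver using (solve-∀)
open import Data.Product.Base using (∃-syntax; _,_)
open import Function.Base using (_∘_; id)
open import Relation.Binary.PropositionalEquality
open import Relation.Nullary.Decidable using (isYes≗does)

private variable A : Set

indicator : Bool → ℕ
indicator true  = 1
indicator false = 0

count : (A → Bool) → List A → ℕ
count p []       = 0
count p (x ∷ xs) = indicator (p x) + count p xs

length-filter≡count : ∀ (p : A → Bool) xs → length (filter (λ x → p x ≟ᵇ true) xs) ≡ count p xs
length-filter≡count p []       = refl
length-filter≡count p (x ∷ xs) with p x
... | true  = cong suc (length-filter≡count p xs)
... | false = length-filter≡count p xs

count-cong : ∀ {p q : A → Bool} → p ≗ q → ∀ xs → count p xs ≡ count q xs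
count-cong p≗q []       = refl
count-cong p≗q (x ∷ xs) = cong₂ _+_ (cong indicator (p≗q x)) (count-cong p≗q xs)

count-false : ∀ (xs : List A) → count (λ _ → false) xs ≡ 0
count-false []       = refl
count-false (x ∷ xs) = count-false xs

countWords : (List Step → Bool) → ℕ → ℕ
countWords p n = count p (allSeqs n)

countWords-suc : ∀ p n →
  countWords p (suc n) ≡ countWords (p ∘ (U ∷_)) n + countWords (p ∘ (Dn ∷_)) n
countWords-suc p n = go (allSeqs n)
  where
  go : ∀ ws → count p (concatMap (λ w → (U ∷ w) ∷ (Dn ∷ w) ∷ []) ws)
            ≡ count (p ∘ (U ∷_)) ws + count (p ∘ (Dn ∷_)) ws
  go []       = refl
  go (w ∷ ws) = trans (cong (λ c → u + (d + c)) (go ws)) (trans (sym (+-assoc u d _)) (interchange u d _ _))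
    where
    u = indicator (p (U ∷ w))
    d = indicator (p (Dn ∷ w))

countWords-take-drop : ∀ a b (f g : List Step → Bool) →
  countWords (λ w → f (take a w) ∧ g (drop a w)) (a + b) ≡ countWords f a * countWords g b
countWords-take-drop zero b f g with f []
... | true  = sym (+-identityʳ _)
... | false = count-false (allSeqs b)
countWords-take-drop (suc a) b f g = begin
    countWords (λ w → f (take (suc a) w) ∧ g (drop (suc a) w)) (suc (a + b))
  ≡⟨ countWords-suc _ (a + b) ⟩
    countWords (λ w → f (U ∷ take a w) ∧ g (drop a w)) (a + b)
      + countWords (λ w → f (Dn ∷ take a w) ∧ g (drop a w)) (a + b)
  ≡⟨ cong₂ _+_ (countWords-take-drop a b (f ∘ (U ∷_)) g) (countWords-take-drop a b (f ∘ (Dn ∷_)) g) ⟩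
    countWords (f ∘ (U ∷_)) a * countWords g b + countWords (f ∘ (Dn ∷_)) a * countWords g b
  ≡⟨ *-distribʳ-+ (countWords g b) (countWords (f ∘ (U ∷_)) a) _ ⟨
    (countWords (f ∘ (U ∷_)) a + countWords (f ∘ (Dn ∷_)) a) * countWords g b
  ≡⟨ cong (_* countWords g b) (countWords-suc f a) ⟨
    countWords f (suc a) * countWords g b
  ∎
  where open ≡-Reasoning

landsAt : ℕ → Maybe ℕ → Bool
landsAt j (just h) = h ≡ᵇ j
landsAt j nothing  = false

endsAt≗landsAt∘walk : ∀ j → endsAt j ≗ landsAt j ∘ walk 0
endsAt≗landsAt∘walk j w with walk 0 w
... | just h  = isYes≗does (h ≟ j)
... | nothing = refl

walkCount : ℕ → ℕ → ℕ → ℕ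
walkCount zero    h       j = indicator (h ≡ᵇ j)
walkCount (suc m) zero    j = walkCount m 1 j
walkCount (suc m) (suc h) j = walkCount m (suc (suc h)) j + walkCount m h j

countWords-walk : ∀ m h j → countWords (landsAt j ∘ walk h) m ≡ walkCount m h j
countWords-walk zero    h       j = +-identityʳ _
countWords-walk (suc m) zero    j = begin
    countWords (landsAt j ∘ walk 0) (suc m)
  ≡⟨ countWords-suc _ m ⟩
    countWords (landsAt j ∘ walk 1) m + count (λ _ → false) (allSeqs m)
  ≡⟨ cong₂ _+_ (countWords-walk m 1 j) (count-false (allSeqs m)) ⟩
    walkCount m 1 j + 0
  ≡⟨ +-identityʳ _ ⟩
    walkCount m 1 j
  ∎
  where open ≡-Reasoning
countWords-walk (suc m) (suc h) j =
  trans (countWords-suc _ m) (cong₂ _+_ (countWords-walk m (suc (suc h)) j) (countWords-walk m h j))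

countWords-endsAt : ∀ m j → countWords (endsAt j) m ≡ walkCount m 0 j
countWords-endsAt m j = trans (count-cong (endsAt≗landsAt∘walk j) (allSeqs m)) (countWords-walk m 0 j)

walkCount-suc-zero : ∀ m h → walkCount (suc m) h 0 ≡ walkCount m h 1
walkCount-suc-zero zero    zero    = refl
walkCount-suc-zero zero    (suc h) = refl
walkCount-suc-zero (suc m) zero    = walkCount-suc-zero m 1
walkCount-suc-zero (suc m) (suc h) = cong₂ _+_ (walkCount-suc-zero m (suc (suc h))) (walkCount-suc-zero m h)

walkCount-suc-suc : ∀ m h j →
  walkCount (suc m) h (suc j) ≡ walkCount m h j + walkCount m h (suc (suc j))
walkCount-suc-suc zero    zero    j = sym (+-identityʳ _)
walkCount-suc-suc zero    (suc h) j = refl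
walkCount-suc-suc (suc m) zero    j = walkCount-suc-suc m 1 j
walkCount-suc-suc (suc m) (suc h) j = begin
    walkCount (suc m) (suc (suc h)) (suc j) + walkCount (suc m) h (suc j)
  ≡⟨ cong₂ _+_ (walkCount-suc-suc m (suc (suc h)) j) (walkCount-suc-suc m h j) ⟩
    (walkCount m (suc (suc h)) j + walkCount m (suc (suc h)) (suc (suc j)))
      + (walkCount m h j + walkCount m h (suc (suc j)))
  ≡⟨ interchange (walkCount m (suc (suc h)) j) _ (walkCount m h j) _ ⟩
    walkCount (suc m) (suc h) j + walkCount (suc m) (suc h) (suc (suc j))
  ∎
  where open ≡-Reasoning

walkCount-< : ∀ {m j} → m < j → walkCount m 0 j ≡ 0
walkCount-< {zero}  {suc j} _         = refl
walkCount-< {suc m} {suc j} (s≤s m<j) = trans (walkCount-suc-suc m 0 j)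
  (cong₂ _+_ (walkCount-< m<j) (walkCount-< (m<n⇒m<1+n (m<n⇒m<1+n m<j))))

walkCount-diagonal : ∀ j → walkCount j 0 j ≡ 1
walkCount-diagonal zero    = refl
walkCount-diagonal (suc j) = trans (walkCount-suc-suc j 0 j)
  (cong₂ _+_ (walkCount-diagonal j) (walkCount-< (m<n⇒m<1+n (n<1+n j))))

-- ballot k r = |D(k + 2r, k)|; the recursion classifies paths by their last step.
ballot : ℕ → ℕ → ℕ
ballot k       zero    = 1
ballot zero    (suc r) = ballot 1 r
ballot (suc k) (suc r) = ballot k (suc r) + ballot (suc (suc k)) r

j+2[1+s]≡2+j+2s : ∀ j s → j + 2 * suc s ≡ suc (suc j) + 2 * s
j+2[1+s]≡2+j+2s = solve-∀

walkCount≡ballot : ∀ k r → walkCount (k + 2 * r) 0 k ≡ ballot k r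
walkCount≡ballot k zero = trans (cong (λ m → walkCount m 0 k) (+-identityʳ k)) (walkCount-diagonal k)
walkCount≡ballot zero (suc r) = begin
    walkCount (2 * suc r) 0 0
  ≡⟨ cong (λ m → walkCount m 0 0) (j+2[1+s]≡2+j+2s 0 r) ⟩
    walkCount (suc (1 + 2 * r)) 0 0
  ≡⟨ walkCount-suc-zero (1 + 2 * r) 0 ⟩
    walkCount (1 + 2 * r) 0 1
  ≡⟨ walkCount≡ballot 1 r ⟩
    ballot 1 r
  ∎
  where open ≡-Reasoning
walkCount≡ballot (suc k) (suc r) = begin
    walkCount (suc k + 2 * suc r) 0 (suc k)
  ≡⟨ walkCount-suc-suc (k + 2 * suc r) 0 k ⟩
    walkCount (k + 2 * suc r) 0 k + walkCount (k + 2 * suc r) 0 (suc (suc k))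
  ≡⟨ cong₂ _+_ (walkCount≡ballot k (suc r))
               (trans (cong (λ m → walkCount m 0 (suc (suc k))) (j+2[1+s]≡2+j+2s k r))
                      (walkCount≡ballot (suc (suc k)) r)) ⟩
    ballot (suc k) (suc r)
  ∎
  where open ≡-Reasoning

-- Σ_{i=1}^{r} f (r - i) · g i, indexed so that convolve f g (suc r) unfolds to
-- f r * g 1 + convolve f (g ∘ suc) r.
convolve : (ℕ → ℕ) → (ℕ → ℕ) → ℕ → ℕ
convolve f g r = sum (applyUpTo (λ i → f (r ∸ suc i) * g (suc i)) r)

convolve-+ˡ : ∀ (f h g : ℕ → ℕ) r →
  convolve (λ x → f x + h x) g r ≡ convolve f g r + convolve h g r
convolve-+ˡ f h g zero    = refl
convolve-+ˡ f h g (suc r) = begin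
    (f r + h r) * g 1 + convolve (λ x → f x + h x) (g ∘ suc) r
  ≡⟨ cong₂ _+_ (*-distribʳ-+ (g 1) (f r) (h r)) (convolve-+ˡ f h (g ∘ suc) r) ⟩
    (f r * g 1 + h r * g 1) + (convolve f (g ∘ suc) r + convolve h (g ∘ suc) r)
  ≡⟨ interchange (f r * g 1) (h r * g 1) _ _ ⟩
    convolve f g (suc r) + convolve h g (suc r)
  ∎
  where open ≡-Reasoning

convolve-last : ∀ (f g : ℕ → ℕ) r → convolve f g (suc r) ≡ convolve (f ∘ suc) g r + f 0 * g (suc r)
convolve-last f g zero    = +-comm (f 0 * g 1) 0
convolve-last f g (suc r) = trans (cong (f (suc r) * g 1 +_) (convolve-last f (g ∘ suc) r))
  (sym (+-assoc (f (suc r) * g 1) (convolve (f ∘ suc) (g ∘ suc) r) (f 0 * g (suc (suc r)))))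

convolve-ballot : ∀ k r → convolve (ballot k) (ballot 0) (suc r) ≡ ballot (suc (suc k)) r
convolve-ballot k       zero    = refl
convolve-ballot zero    (suc r) = begin
    convolve (ballot 0) (ballot 0) (suc (suc r))
  ≡⟨ convolve-last (ballot 0) (ballot 0) (suc r) ⟩
    convolve (ballot 1) (ballot 0) (suc r) + 1 * ballot 1 (suc r)
  ≡⟨ cong₂ _+_ (convolve-ballot 1 r) (*-identityˡ (ballot 1 (suc r))) ⟩
    ballot 3 r + ballot 1 (suc r)
  ≡⟨ +-comm (ballot 3 r) (ballot 1 (suc r)) ⟩
    ballot 2 (suc r)
  ∎
  where open ≡-Reasoning
convolve-ballot (suc k) (suc r) = begin
    convolve (ballot (suc k)) (ballot 0) (suc (suc r))
  ≡⟨ convolve-last (ballot (suc k)) (ballot 0) (suc r) ⟩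
    convolve (λ x → ballot k (suc x) + ballot (suc (suc k)) x) (ballot 0) (suc r) + last
  ≡⟨ cong (_+ last) (convolve-+ˡ (ballot k ∘ suc) (ballot (suc (suc k))) (ballot 0) (suc r)) ⟩
    (convolve (ballot k ∘ suc) (ballot 0) (suc r) + convolve (ballot (suc (suc k))) (ballot 0) (suc r)) + last
  ≡⟨ xy∙z≈xz∙y (convolve (ballot k ∘ suc) (ballot 0) (suc r)) _ last ⟩
    (convolve (ballot k ∘ suc) (ballot 0) (suc r) + last) + convolve (ballot (suc (suc k))) (ballot 0) (suc r)
  ≡⟨ cong (_+ convolve (ballot (suc (suc k))) (ballot 0) (suc r)) (convolve-last (ballot k) (ballot 0) (suc r)) ⟨
    convolve (ballot k) (ballot 0) (suc (suc r)) + convolve (ballot (suc (suc k))) (ballot 0) (suc r)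
  ≡⟨ cong₂ _+_ (convolve-ballot k (suc r)) (convolve-ballot (suc (suc k)) r) ⟩
    ballot (suc (suc (suc k))) (suc r)
  ∎
  where
  open ≡-Reasoning
  last = 1 * ballot 0 (suc (suc r))

binomPred-pascal : ∀ m s → suc m C s ≡ binomPred m s + m C s
binomPred-pascal m zero    = refl
binomPred-pascal m (suc s) = sym (nCk+nC[k+1]≡[n+1]C[k+1] m s)

[1+m]*mCs≡[1+s]*[1+m]C[1+s] : ∀ m s → suc m * (m C s) ≡ suc s * (suc m C suc s)
[1+m]*mCs≡[1+s]*[1+m]C[1+s] zero    zero    = refl
[1+m]*mCs≡[1+s]*[1+m]C[1+s] zero    (suc s) =
  sym (trans (cong (suc (suc s) *_) (k>n⇒nCk≡0 {1} {suc (suc s)} (s≤s (s≤s z≤n)))) (*-zeroʳ (suc (suc s))))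
[1+m]*mCs≡[1+s]*[1+m]C[1+s] (suc m) zero    =
  trans (*-identityʳ (suc (suc m))) (sym (trans (+-identityʳ _) (nC1≡n (suc (suc m)))))
[1+m]*mCs≡[1+s]*[1+m]C[1+s] (suc m) (suc s) = begin
    suc n * X
  ≡⟨ cong (suc n *_) (nCk+nC[k+1]≡[n+1]C[k+1] m s) ⟨
    suc n * (m C s + m C suc s)
  ≡⟨ regroup m (m C s) (m C suc s) ⟩
    (m C s + m C suc s) + (n * (m C s) + n * (m C suc s))
  ≡⟨ cong₂ (λ a b → a + (b + n * (m C suc s))) (nCk+nC[k+1]≡[n+1]C[k+1] m s) ([1+m]*mCs≡[1+s]*[1+m]C[1+s] m s) ⟩
    X + (suc s * X + n * (m C suc s))
  ≡⟨ cong (λ b → X + (suc s * X + b)) ([1+m]*mCs≡[1+s]*[1+m]C[1+s] m (suc s)) ⟩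
    X + (suc s * X + suc (suc s) * Y)
  ≡⟨ collect s X Y ⟩
    suc (suc s) * (X + Y)
  ≡⟨ cong (suc (suc s) *_) (nCk+nC[k+1]≡[n+1]C[k+1] n (suc s)) ⟩
    suc (suc s) * (suc n C suc (suc s))
  ∎
  where
  open ≡-Reasoning
  n = suc m
  X = n C suc s
  Y = n C suc (suc s)
  regroup : ∀ m a b → suc (suc m) * (a + b) ≡ (a + b) + (suc m * a + suc m * b)
  regroup = solve-∀
  collect : ∀ s X Y → X + (suc s * X + suc (suc s) * Y) ≡ suc (suc s) * (X + Y)
  collect = solve-∀

[1+m]*binomPred≡s*[1+m]Cs : ∀ m s → suc m * binomPred m s ≡ s * (suc m C s)
[1+m]*binomPred≡s*[1+m]Cs m zero    = *-zeroʳ (suc m)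
[1+m]*binomPred≡s*[1+m]Cs m (suc s) = [1+m]*mCs≡[1+s]*[1+m]C[1+s] m s

[1+2s]C[1+s]≡[1+2s]Cs : ∀ s → suc (2 * s) C suc s ≡ suc (2 * s) C s
[1+2s]C[1+s]≡[1+2s]Cs s = trans (nCk≡nC[n∸k] (s≤s (m≤m+n s (s + 0))))
  (cong (suc (2 * s) C_) (trans (m+n∸m≡n s (s + 0)) (+-identityʳ s)))

-- The reflection principle B(j, s) = C(j + 2s, s) - C(j + 2s, s - 1), without subtraction.
ballot+binomPred≡C : ∀ j s → ballot j s + binomPred (j + 2 * s) s ≡ (j + 2 * s) C s
ballot+binomPred≡C j       zero    = refl
ballot+binomPred≡C zero    (suc s) =
  subst (λ n → ballot 1 s + binomPred n (suc s) ≡ n C suc s) (sym (j+2[1+s]≡2+j+2s 0 s)) (begin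
    ballot 1 s + suc m C s
  ≡⟨ cong (ballot 1 s +_) (binomPred-pascal m s) ⟩
    ballot 1 s + (binomPred m s + m C s)
  ≡⟨ +-assoc (ballot 1 s) (binomPred m s) (m C s) ⟨
    (ballot 1 s + binomPred m s) + m C s
  ≡⟨ cong (_+ m C s) (ballot+binomPred≡C 1 s) ⟩
    m C s + m C s
  ≡⟨ cong (m C s +_) ([1+2s]C[1+s]≡[1+2s]Cs s) ⟨
    m C s + m C suc s
  ≡⟨ nCk+nC[k+1]≡[n+1]C[k+1] m s ⟩
    suc m C suc s
  ∎)
  where
  open ≡-Reasoning
  m = 1 + 2 * s
ballot+binomPred≡C (suc j) (suc s) = begin
    (a + b) + suc m C s
  ≡⟨ cong ((a + b) +_) (binomPred-pascal m s) ⟩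
    (a + b) + (binomPred m s + m C s)
  ≡⟨ cong (_+ (binomPred m s + m C s)) (+-comm a b) ⟩
    (b + a) + (binomPred m s + m C s)
  ≡⟨ interchange b a (binomPred m s) (m C s) ⟩
    (b + binomPred m s) + (a + m C s)
  ≡⟨ cong₂ _+_ reflected (ballot+binomPred≡C j (suc s)) ⟩
    m C s + m C suc s
  ≡⟨ nCk+nC[k+1]≡[n+1]C[k+1] m s ⟩
    suc m C suc s
  ∎
  where
  open ≡-Reasoning
  m = j + 2 * suc s
  a = ballot j (suc s)
  b = ballot (suc (suc j)) s
  reflected : b + binomPred m s ≡ m C s
  reflected = subst (λ n → b + binomPred n s ≡ n C s) (sym (j+2[1+s]≡2+j+2s j s))
    (ballot+binomPred≡C (suc (suc j)) s)

ballot-formula : ∀ j s → suc (j + 2 * s) * ballot j s ≡ suc j * (suc (j + 2 * s) C s)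
ballot-formula j s = +-cancelʳ-≡ (s * X + s * X) _ _ (begin
    suc m * ballot j s + (s * X + s * X)
  ≡⟨ cong (λ t → suc m * ballot j s + (t + s * X)) ([1+m]*binomPred≡s*[1+m]Cs m s) ⟨
    suc m * ballot j s + (suc m * binomPred m s + s * X)
  ≡⟨ factor (suc m) (ballot j s) (binomPred m s) (s * X) ⟩
    suc m * (ballot j s + binomPred m s) + s * X
  ≡⟨ cong₂ (λ a b → suc m * a + b) (ballot+binomPred≡C j s) (sym ([1+m]*binomPred≡s*[1+m]Cs m s)) ⟩
    suc m * (m C s) + suc m * binomPred m s
  ≡⟨ factor′ (suc m) (binomPred m s) (m C s) ⟩
    suc m * (binomPred m s + m C s)
  ≡⟨ cong (suc m *_) (binomPred-pascal m s) ⟨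
    suc m * X
  ≡⟨ expand j s X ⟩
    suc j * X + (s * X + s * X)
  ∎)
  where
  open ≡-Reasoning
  m = j + 2 * s
  X = suc m C s
  factor : ∀ a b c d → a * b + (a * c + d) ≡ a * (b + c) + d
  factor = solve-∀
  factor′ : ∀ a p q → a * q + a * p ≡ a * (p + q)
  factor′ = solve-∀
  expand : ∀ j s X → suc (j + 2 * s) * X ≡ suc j * X + (s * X + s * X)
  expand = solve-∀

⌊2*n/2⌋≡n : ∀ n → ⌊ 2 * n /2⌋ ≡ n
⌊2*n/2⌋≡n zero    = refl
⌊2*n/2⌋≡n (suc n) = trans (cong ⌊_/2⌋ (j+2[1+s]≡2+j+2s 0 n)) (cong suc (⌊2*n/2⌋≡n n))

⌊[k+2r∸k]/2⌋≡r : ∀ k r → ⌊ (k + 2 * r ∸ k) /2⌋ ≡ r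
⌊[k+2r∸k]/2⌋≡r k r = trans (cong ⌊_/2⌋ (m+n∸m≡n k (2 * r))) (⌊2*n/2⌋≡n r)

applyUpTo-cong< : ∀ {f g : ℕ → A} n → (∀ {i} → i < n → f i ≡ g i) → applyUpTo f n ≡ applyUpTo g n
applyUpTo-cong< zero    f≡g = refl
applyUpTo-cong< (suc n) f≡g = cong₂ _∷_ (f≡g (s≤s z≤n)) (applyUpTo-cong< n (f≡g ∘ s≤s))

countWords-isMDPwith : ∀ k r i → i ≤ r →
  countWords (isMDPwith (k + 2 * r) k i) (k + 2 * r) ≡ ballot k (r ∸ i) * ballot 0 i
countWords-isMDPwith k r i i≤r = begin
    countWords (isMDPwith n k i) n
  ≡⟨ cong (countWords (isMDPwith n k i)) (m∸n+n≡m 2i≤n) ⟨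
    countWords (isMDPwith n k i) (n ∸ 2 * i + 2 * i)
  ≡⟨ countWords-take-drop (n ∸ 2 * i) (2 * i) (endsAt k) (endsAt 0) ⟩
    countWords (endsAt k) (n ∸ 2 * i) * countWords (endsAt 0) (2 * i)
  ≡⟨ cong₂ _*_ (countWords-endsAt (n ∸ 2 * i) k) (countWords-endsAt (2 * i) 0) ⟩
    walkCount (n ∸ 2 * i) 0 k * walkCount (2 * i) 0 0
  ≡⟨ cong (λ a → walkCount a 0 k * walkCount (2 * i) 0 0) prefixLength ⟩
    walkCount (k + 2 * (r ∸ i)) 0 k * walkCount (2 * i) 0 0
  ≡⟨ cong₂ _*_ (walkCount≡ballot k (r ∸ i)) (walkCount≡ballot 0 i) ⟩
    ballot k (r ∸ i) * ballot 0 i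
  ∎
  where
  open ≡-Reasoning
  n = k + 2 * r
  2i≤2r : 2 * i ≤ 2 * r
  2i≤2r = *-monoʳ-≤ 2 i≤r
  2i≤n : 2 * i ≤ n
  2i≤n = ≤-trans 2i≤2r (m≤n+m (2 * r) k)
  prefixLength : n ∸ 2 * i ≡ k + 2 * (r ∸ i)
  prefixLength = trans (+-∸-assoc k 2i≤2r) (cong (k +_) (sym (*-distribˡ-∸ 2 r i)))

mdpCount≡convolve : ∀ k r → mdpCount (k + 2 * r) k ≡ convolve (ballot k) (ballot 0) r
mdpCount≡convolve k r = begin
    mdpCount n k
  ≡⟨ cong (λ l → sum (map term (upTo l))) (⌊[k+2r∸k]/2⌋≡r k r) ⟩
    sum (map term (upTo r))
  ≡⟨ cong sum (map-applyUpTo id term r) ⟩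
    sum (applyUpTo term r)
  ≡⟨ cong sum (applyUpTo-cong< r term≡) ⟩
    convolve (ballot k) (ballot 0) r
  ∎
  where
  open ≡-Reasoning
  n = k + 2 * r
  term : ℕ → ℕ
  term j = length (filter (λ w → isMDPwith n k (suc j) w ≟ᵇ true) (allSeqs n))
  term≡ : ∀ {j} → j < r → term j ≡ ballot k (r ∸ suc j) * ballot 0 (suc j)
  term≡ j<r = trans (length-filter≡count _ (allSeqs n)) (countWords-isMDPwith k r _ j<r)

[k+2r+1]*convolve≡[k+3]*binomPred : ∀ k r →
  (k + 2 * r + 1) * convolve (ballot k) (ballot 0) r ≡ (k + 3) * binomPred (k + 2 * r + 1) r
[k+2r+1]*convolve≡[k+3]*binomPred k zero    = trans (*-zeroʳ (k + 0 + 1)) (sym (*-zeroʳ (k + 3)))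
[k+2r+1]*convolve≡[k+3]*binomPred k (suc s) = begin
    (k + 2 * suc s + 1) * convolve (ballot k) (ballot 0) (suc s)
  ≡⟨ cong₂ _*_ length≡ (convolve-ballot k s) ⟩
    suc (suc (suc k) + 2 * s) * ballot (suc (suc k)) s
  ≡⟨ ballot-formula (suc (suc k)) s ⟩
    (3 + k) * (suc (suc (suc k) + 2 * s) C s)
  ≡⟨ cong₂ (λ a l → a * (l C s)) (+-comm 3 k) (sym length≡) ⟩
    (k + 3) * ((k + 2 * suc s + 1) C s)
  ∎
  where
  open ≡-Reasoning
  length≡ : k + 2 * suc s + 1 ≡ suc (suc (suc k) + 2 * s)
  length≡ = trans (+-comm (k + 2 * suc s) 1) (cong suc (j+2[1+s]≡2+j+2s k s))

k≤n⇒2∣n+k⇒n≡k+2r : ∀ {n k} → k ≤ n → 2 ∣ n + k → ∃[ r ] n ≡ k + 2 * r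
k≤n⇒2∣n+k⇒n≡k+2r {n} {k} k≤n 2∣n+k
  with ∣m+n∣m⇒∣n (subst (2 ∣_) n+k≡2k+[n∸k] 2∣n+k) (m∣m*n k)
  where
  rearrange : ∀ k d → (k + d) + k ≡ 2 * k + d
  rearrange = solve-∀
  n+k≡2k+[n∸k] : n + k ≡ 2 * k + (n ∸ k)
  n+k≡2k+[n∸k] = trans (cong (_+ k) (sym (m+[n∸m]≡n k≤n))) (rearrange k (n ∸ k))
... | divides r n∸k≡r*2 = r , trans (sym (m+[n∸m]≡n k≤n)) (cong (k +_) (trans n∸k≡r*2 (*-comm r 2)))

corollary3p9 : (n k : ℕ) → 2 ≤ n → k ≤ n → 2 ∣ (n + k) →
    (n + 1) * mdpCount n k ≡ (k + 3) * binomPred (n + 1) ⌊ (n ∸ k) /2⌋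
corollary3p9 n k _ k≤n 2∣n+k with k≤n⇒2∣n+k⇒n≡k+2r k≤n 2∣n+k
... | r , refl = begin
    (k + 2 * r + 1) * mdpCount (k + 2 * r) k
  ≡⟨ cong ((k + 2 * r + 1) *_) (mdpCount≡convolve k r) ⟩
    (k + 2 * r + 1) * convolve (ballot k) (ballot 0) r
  ≡⟨ [k+2r+1]*convolve≡[k+3]*binomPred k r ⟩
    (k + 3) * binomPred (k + 2 * r + 1) r
  ≡⟨ cong (λ i → (k + 3) * binomPred (k + 2 * r + 1) i) (⌊[k+2r∸k]/2⌋≡r k r) ⟨
    (k + 3) * binomPred (k + 2 * r + 1) ⌊ (k + 2 * r ∸ k) /2⌋
  ∎
  where open ≡-Reasoning
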